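{- For every graph $H$ (with at least one edge) there exists a constant $c(H) > 0$ such that $$p_c(n,H) \,\geqslant\, c(H)\, n^{ -1/\lambda^*(H)}$$ for every $n \in \mathbb{N}$.
   Context: $\lambda^*(H) := \min_{e \in E(H)} \max_{F \subset H - e} \frac{e(F)}{v(F)}$, the maximum over subgraphs $F$ of $H - e$. For a graph $G$ on $[n]$, the $H$-bootstrap process is $G_0 = G$, $G_{t+1} = G_t \cup \{ e \in E(K_n) : \exists \text{ a copy } H' \text{ of } H \text{ in } K_n \text{ with } e \in H' \subset G_t \cup \{e\}\}$, $\langle G \rangle_H = \bigcup_t G_t$. $G_{n,p}$ is the Erdős–Rényi random graph on $[n]$, and $p_c(n,H) = \inf\{ p : \mathbb{P}(\langle G_{n,p} \rangle_H = K_n) \geqslant 1/2\}$.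
   Formalization: The edge probability p, over which the infimum defining $p_c(n,H)$ is taken, ranges only over the rationals, and the constant $c(H)$ is taken in the rationals. -}

module Defs where

import Data.Bool as Bool
open import Data.Bool using (Bool; true; false; _∧_; _∨_; not; if_then_else_)
open import Data.Nat as ℕ using (ℕ; zero; suc)
open import Data.Fin as Fin using (Fin)
open import Data.Vec as Vec using (Vec; []; _∷_; lookup)
open import Data.List as List using (List; []; _∷_; map; concatMap; filter; length; allFin; foldr)
open import Data.Bool.ListAction using (any; all)
open import Data.Product using (_×_; _,_; proj₁; proj₂; Σ; ∃)
open import Data.Integer using (+_)
open import Data.Rational as ℚ using (ℚ; 0ℚ; 1ℚ)
open import Relation.Nullary using (does)
open import Relation.Binary.PropositionalEquality using (_≡_; _≢_)

record Graph : Set where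
  field
    V     : ℕ
    adj   : Fin V → Fin V → Bool
    sym   : ∀ i j → adj i j ≡ adj j i
    irref : ∀ i → adj i i ≡ false
open Graph public

-- unordered pairs {i,j} of Fin k, represented as (i , j) with i < j
Pair : ℕ → Set
Pair k = Fin k × Fin k

pairs : (k : ℕ) → List (Pair k)
pairs k = concatMap (λ i → map (λ j → (i , j)) (filter (λ j → i Fin.<? j) (allFin k))) (allFin k)

countB : {A : Set} → (A → Bool) → List A → ℕ
countB p xs = length (filter (λ x → Bool._≟_ (p x) true) xs)

IsEdge : (H : Graph) → Pair (V H) → Set
IsEdge H (i , j) = (i Fin.< j) × (adj H i j ≡ true)

-- a subgraph F of H - e: a vertex set S and an edge set A (read on pairs i < j)
-- such that every edge of F is an edge of H other than e with both ends in S
record SubgraphMinus (H : Graph) (e : Pair (V H)) : Set where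
  field
    S : Fin (V H) → Bool
    A : Fin (V H) → Fin (V H) → Bool
    A⊆ : ∀ i j → i Fin.< j → A i j ≡ true →
         (adj H i j ≡ true) × (S i ≡ true) × (S j ≡ true) × ((i , j) ≢ e)

vF : ∀ {H e} → SubgraphMinus H e → ℕ
vF {H} F = countB (SubgraphMinus.S F) (allFin (V H))

eF : ∀ {H e} → SubgraphMinus H e → ℕ
eF {H} F = countB (λ { (i , j) → SubgraphMinus.A F i j }) (pairs (V H))

-- max_{F ⊂ H - e} e(F)/v(F) = a / b   (b > 0; F ranges over subgraphs with v(F) ≥ 1)
MaxDensity : (H : Graph) (e : Pair (V H)) (a b : ℕ) → Set
MaxDensity H e a b =
  (∃ λ (F : SubgraphMinus H e) → (1 ℕ.≤ vF F) × (eF F ℕ.* b ≡ a ℕ.* vF F)) ×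
  (∀ (F : SubgraphMinus H e) → 1 ℕ.≤ vF F → eF F ℕ.* b ℕ.≤ a ℕ.* vF F)

-- λ*(H) = a / b, i.e. min over edges e of (max density of H - e) equals a / b
IsLambdaStar : (H : Graph) (a b : ℕ) → Set
IsLambdaStar H a b =
  (1 ℕ.≤ b) ×
  (∃ λ e → IsEdge H e × MaxDensity H e a b) ×
  (∀ e → IsEdge H e → ∃ λ (F : SubgraphMinus H e) →
      (1 ℕ.≤ vF F) × (a ℕ.* vF F ℕ.≤ eF F ℕ.* b))

HasEdge : Graph → Set
HasEdge H = ∃ λ e → IsEdge H e

eqPair : ∀ {n} → Pair n → Pair n → Bool
eqPair (i , j) (k , l) = does (i Fin.≟ k) ∧ does (j Fin.≟ l)

memB : ∀ {n} → Pair n → List (Pair n) → Bool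
memB x ys = any (eqPair x) ys

norm : ∀ {n} → Fin n → Fin n → Pair n
norm x y = if does (x Fin.<? y) then (x , y) else (y , x)

allVecs : (n k : ℕ) → List (Vec (Fin n) k)
allVecs n zero    = [] ∷ []
allVecs n (suc k) = concatMap (λ x → map (x ∷_) (allVecs n k)) (allFin n)

injB : ∀ {n k} → Vec (Fin n) k → Bool
injB {k = k} φ = all (λ { (i , j) → not (does (lookup φ i Fin.≟ lookup φ j)) }) (pairs k)

edgesH : (H : Graph) → List (Pair (V H))
edgesH H = filter (λ { (i , j) → Bool._≟_ (adj H i j) true }) (pairs (V H))

copyEdges : ∀ {n} (H : Graph) → Vec (Fin n) (V H) → List (Pair n)
copyEdges H φ = map (λ { (i , j) → norm (lookup φ i) (lookup φ j) }) (edgesH H)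

triggered : ∀ {n} (H : Graph) → List (Pair n) → Pair n → Bool
triggered {n} H G e =
  any (λ φ → injB φ ∧ memB e (copyEdges H φ)
                    ∧ all (λ f → memB f G ∨ eqPair f e) (copyEdges H φ))
      (allVecs n (V H))

step : ∀ {n} (H : Graph) → List (Pair n) → List (Pair n)
step {n} H G = filter (λ e → Bool._≟_ (memB e G ∨ triggered H G e) true) (pairs n)

iterG : ∀ {n} (H : Graph) → ℕ → List (Pair n) → List (Pair n)
iterG H zero    G = G
iterG H (suc t) G = step H (iterG H t G)

-- ⟨G⟩_H = K_n.  The process G_0 ⊆ G_1 ⊆ … lives inside the N = C(n,2) pairs,
-- so it is stationary from step N on; ⟨G⟩_H = G_N.
percolates : ∀ {n} (H : Graph) → List (Pair n) → Bool
percolates {n} H G = all (λ e → memB e (iterG H (length (pairs n)) G)) (pairs n)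

-- P(⟨G_{n,p}⟩_H = K_n) as an exact finite sum over all graphs on [n]

subsetsL : {A : Set} → List A → List (List A)
subsetsL []       = [] ∷ []
subsetsL (x ∷ xs) = map (x ∷_) (subsetsL xs) List.++ subsetsL xs

powℚ : ℚ → ℕ → ℚ
powℚ x zero    = 1ℚ
powℚ x (suc k) = x ℚ.* powℚ x k

ℕtoℚ : ℕ → ℚ
ℕtoℚ m = (+ m) ℚ./ 1

probPerc : (n : ℕ) (H : Graph) (p : ℚ) → ℚ
probPerc n H p =
  foldr ℚ._+_ 0ℚ
    (map (λ G → if percolates H G
                then powℚ p (length G) ℚ.* powℚ (1ℚ ℚ.- p) (length (pairs n) ℕ.∸ length G)
                else 0ℚ)
         (subsetsL (pairs n)))

module Submission where

-- If G percolates then either G is already K_n, or some pair e is added in the first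
-- step; then a copy φ(H) with e = φ(ε) lies in G ∪ {e}, so for EVERY subgraph F of H - ε
-- the copy φ(F) lies in G.  Choosing for each edge ε a subgraph F_ε ⊆ H - ε of density
-- e(F_ε)/v(F_ε) ≥ λ*(H) = a/b and using the union bound,
--   P(⟨G_{n,p}⟩_H = K_n) ≤ p^(n choose 2) + Σ_ε n^v(F_ε) p^e(F_ε).
-- If p^a n^b < c^a with c = δ^b, each term is at most δ, and δ = 1/(4(E+1)) (E the number
-- of pairs of vertices of H) makes the total at most 1/4 < 1/2.

open import Defs hiding (sym)
open import Data.Nat using (ℕ; _≤_)
open import Data.Product using (Σ; _×_)
open import Data.Rational using (ℚ; 0ℚ; 1ℚ; ½; _<_; _*_)
open import Data.Rational as ℚ using ()

open import Data.Bool as Bool using (Bool; true; false; _∧_; _∨_; not; if_then_else_; T)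
open import Data.Bool.Properties using (T-≡)
open import Data.Bool.ListAction using (any; all)
open import Data.Empty using (⊥-elim)
open import Data.Fin as Fin using (Fin)
import Data.Fin.Properties as FinP
open import Data.Integer as ℤ using (+_)
import Data.Integer.Properties as ℤP
open import Data.List as List using (List; []; _∷_; map; concatMap; filter; length; allFin; foldr; _++_)
import Data.List.Properties as ListP
open import Data.List.Membership.Propositional using (_∈_; _∉_; find; lose)
open import Data.List.Membership.Propositional.Properties
  using (∈-map⁺; ∈-map⁻; ∈-filter⁺; ∈-filter⁻; ∈-concat⁺′; ∈-concat⁻′; ∈-allFin; ∈-length)
open import Data.List.Relation.Unary.Any using (here; there)
open import Data.List.Relation.Unary.Any.Properties using (any⁺; any⁻)
open import Data.List.Relation.Unary.All as All using (All; []; _∷_)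
import Data.List.Relation.Unary.All.Properties as AllP
open AllP using (all⁺; all⁻)
import Data.List.Relation.Unary.AllPairs as AllPairs
import Data.List.Relation.Unary.AllPairs.Properties as AllPairsP
open import Data.List.Relation.Unary.Unique.Propositional using (Unique)
import Data.List.Relation.Unary.Unique.Propositional.Properties as Unique
open import Data.Nat as ℕ using (zero; suc; z≤n; s≤s)
import Data.Nat.Coprimality as Coprime
import Data.Nat.Properties as ℕP
open import Data.Product using (_,_; proj₁; proj₂; ∃; swap)
open import Data.Product.Properties using (,-injective)
open import Data.Rational using (mkℚ)
import Data.Rational.Properties as ℚP
open import Data.Rational.Solver using (module +-*-Solver)
open +-*-Solver using (solve; _:+_; _:*_; _:-_; _:=_; con)
import Data.Rational.Unnormalised as ℚᵘ
import Data.Rational.Unnormalised.Properties as ℚᵘP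
open import Data.Sum using (_⊎_; inj₁; inj₂; [_,_]′)
open import Data.Unit using (⊤; tt)
open import Data.Vec using (Vec; []; _∷_; lookup)
open import Function using (_∘_; case_of_; Equivalence)
open import Relation.Binary using (tri<; tri≈; tri>)
open import Relation.Binary.PropositionalEquality
open import Relation.Nullary using (Dec; yes; no; ¬_; does; ¬?)
open import Relation.Nullary.Decidable using (map′; _×-dec_; dec-true; dec-false; toWitness)

to≡ : ∀ {b} → T b → b ≡ true
to≡ = Equivalence.to T-≡

fromT : ∀ {b} → b ≡ true → T b
fromT = Equivalence.from T-≡

any-witness : ∀ {A : Set} (f : A → Bool) xs → any f xs ≡ true → ∃ λ x → x ∈ xs × f x ≡ true
any-witness f xs e with find (any⁻ f xs (fromT e))
... | x , x∈xs , fx = x , x∈xs , to≡ fx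

any-intro : ∀ {A : Set} (f : A → Bool) {x} xs → x ∈ xs → f x ≡ true → any f xs ≡ true
any-intro f xs x∈xs fx = to≡ (any⁺ f (lose x∈xs (fromT fx)))

all-elim : ∀ {A : Set} (f : A → Bool) xs → all f xs ≡ true → ∀ {x} → x ∈ xs → f x ≡ true
all-elim f xs e x∈xs = to≡ (All.lookup (all⁺ f xs (fromT e)) x∈xs)

all-intro : ∀ {A : Set} (f : A → Bool) xs → (∀ {x} → x ∈ xs → f x ≡ true) → all f xs ≡ true
all-intro f xs h = to≡ (all⁻ f (All.tabulate (fromT ∘ h)))

does-true : ∀ {A : Set} (a? : Dec A) → does a? ≡ true → A
does-true (yes a) _ = a
does-true (no _) ()

∧-split : ∀ {a b} → a ∧ b ≡ true → a ≡ true × b ≡ true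
∧-split {true} e = refl , e

∧-join : ∀ {a b} → a ≡ true → b ≡ true → a ∧ b ≡ true
∧-join refl refl = refl

∨-split : ∀ {a b} → a ∨ b ≡ true → a ≡ true ⊎ b ≡ true
∨-split {true} _ = inj₁ refl
∨-split {false} e = inj₂ e

∨-inl : ∀ {a} b → a ≡ true → a ∨ b ≡ true
∨-inl b refl = refl

∨-inr : ∀ a {b} → b ≡ true → a ∨ b ≡ true
∨-inr true _ = refl
∨-inr false e = e

-- Unordered pairs.  The Boolean pair equality  eqPair  of Defs is, definitionally,
-- the decision procedure  _≟P_  below, so membership  memB  is list membership.

module _ {k : ℕ} where

  _≟P_ : (x y : Pair k) → Dec (x ≡ y)
  (i , j) ≟P (i′ , j′) = map′ (λ (p , q) → cong₂ _,_ p q) ,-injective ((i Fin.≟ i′) ×-dec (j Fin.≟ j′))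

  eqPair-≡ : (x y : Pair k) → eqPair x y ≡ true → x ≡ y
  eqPair-≡ x y = does-true (x ≟P y)

  eqPair-refl : (x : Pair k) → eqPair x x ≡ true
  eqPair-refl x = dec-true (x ≟P x) refl

  eqPair-≢ : (x y : Pair k) → x ≢ y → eqPair x y ≡ false
  eqPair-≢ x y = dec-false (x ≟P y)

  memB-∈ : (x : Pair k) (ys : List (Pair k)) → memB x ys ≡ true → x ∈ ys
  memB-∈ x ys e with any-witness (eqPair x) ys e
  ... | y , y∈ys , x=y = subst (_∈ ys) (sym (eqPair-≡ x y x=y)) y∈ys

  private
    row : Fin k → List (Pair k)
    row i = map (λ j → (i , j)) (filter (λ j → i Fin.<? j) (allFin k))

    row-spec : ∀ {i} {v : Pair k} → v ∈ row i → proj₁ v ≡ i × i Fin.< proj₂ v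
    row-spec {i} m with ∈-map⁻ (λ j → (i , j)) m
    ... | j , j∈ , refl = refl , proj₂ (∈-filter⁻ (λ j → i Fin.<? j) {xs = allFin k} j∈)

  ∈-pairs : ∀ {i j : Fin k} → i Fin.< j → (i , j) ∈ pairs k
  ∈-pairs {i} {j} i<j =
    ∈-concat⁺′ (∈-map⁺ (λ j → (i , j)) (∈-filter⁺ (λ j → i Fin.<? j) (∈-allFin j) i<j))
               (∈-map⁺ row (∈-allFin i))

  pairs-ordered : ∀ {i j : Fin k} → (i , j) ∈ pairs k → i Fin.< j
  pairs-ordered m with ∈-concat⁻′ (map row (allFin k)) m
  ... | _ , v∈row , row∈ with ∈-map⁻ row row∈
  ... | _ , _ , refl with row-spec v∈row
  ... | refl , i<j = i<j

  pairs-unique : Unique (pairs k)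
  pairs-unique = Unique.concat⁺ (AllP.map⁺ (All.tabulate (λ {i} _ → row-unique i)))
                   (AllPairsP.map⁺ (AllPairs.map rows-disjoint (Unique.allFin⁺ k)))
    where
    row-unique : ∀ i → Unique (row i)
    row-unique i = Unique.map⁺ (proj₂ ∘ ,-injective) (Unique.filter⁺ (λ j → i Fin.<? j) (Unique.allFin⁺ k))
    rows-disjoint : ∀ {i i′} → i ≢ i′ → ∀ {v} → ¬ (v ∈ row i × v ∈ row i′)
    rows-disjoint i≢i′ (m , m′) = i≢i′ (trans (sym (proj₁ (row-spec m))) (proj₁ (row-spec m′)))

  allIn : List (Pair k) → List (Pair k) → Bool
  allIn T G = all (λ t → memB t G) T

  norm-cases : (x y : Fin k) → (x Fin.< y × norm x y ≡ (x , y)) ⊎ (¬ x Fin.< y × norm x y ≡ (y , x))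
  norm-cases x y with Fin.toℕ x ℕ.<ᵇ Fin.toℕ y in eq
  ... | true = inj₁ (ℕP.<ᵇ⇒< (Fin.toℕ x) (Fin.toℕ y) (fromT eq) , refl)
  ... | false = inj₂ ((λ x<y → subst T eq (ℕP.<⇒<ᵇ x<y)) , refl)

  norm-inj : ∀ (x y u v : Fin k) → norm x y ≡ norm u v → (x ≡ u × y ≡ v) ⊎ (x ≡ v × y ≡ u)
  norm-inj x y u v e with norm-cases x y | norm-cases u v
  ... | inj₁ (_ , e₁) | inj₁ (_ , e₂) = inj₁ (,-injective (trans (sym e₁) (trans e e₂)))
  ... | inj₁ (_ , e₁) | inj₂ (_ , e₂) = inj₂ (,-injective (trans (sym e₁) (trans e e₂)))
  ... | inj₂ (_ , e₁) | inj₁ (_ , e₂) = inj₂ (swap (,-injective (trans (sym e₁) (trans e e₂))))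
  ... | inj₂ (_ , e₁) | inj₂ (_ , e₂) = inj₁ (swap (,-injective (trans (sym e₁) (trans e e₂))))

ℕtoℚ-mkℚ : ∀ m → ℕtoℚ m ≡ mkℚ (+ m) 0 (Coprime.sym (Coprime.1-coprimeTo m))
ℕtoℚ-mkℚ m = ℚP.normalize-coprime (Coprime.sym (Coprime.1-coprimeTo m))

ℕtoℚ-suc : ∀ m → ℕtoℚ (suc m) ≡ 1ℚ ℚ.+ ℕtoℚ m
ℕtoℚ-suc m rewrite ℕtoℚ-mkℚ (suc m) | ℕtoℚ-mkℚ m =
  ℚP.toℚᵘ-injective (ℚᵘP.≃-trans (ℚᵘ.*≡* cross) (ℚᵘP.≃-sym (ℚP.toℚᵘ-homo-+ 1ℚ m/1)))
  where
  m/1 : ℚ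
  m/1 = mkℚ (+ m) 0 (Coprime.sym (Coprime.1-coprimeTo m))
  cross : + suc m ℤ.* (+ 1 ℤ.* + 1) ≡ (+ 1 ℤ.* + 1 ℤ.+ + m ℤ.* + 1) ℤ.* + 1
  cross = trans (ℤP.*-identityʳ (+ suc m))
                (sym (trans (ℤP.*-identityʳ _) (cong (λ z → + 1 ℤ.+ z) (ℤP.*-identityʳ (+ m)))))

ℕtoℚ-+ : ∀ m k → ℕtoℚ (m ℕ.+ k) ≡ ℕtoℚ m ℚ.+ ℕtoℚ k
ℕtoℚ-+ zero k = sym (ℚP.+-identityˡ _)
ℕtoℚ-+ (suc m) k rewrite ℕtoℚ-suc (m ℕ.+ k) | ℕtoℚ-+ m k | ℕtoℚ-suc m =
  sym (ℚP.+-assoc 1ℚ (ℕtoℚ m) (ℕtoℚ k))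

ℕtoℚ-* : ∀ m k → ℕtoℚ (m ℕ.* k) ≡ ℕtoℚ m ℚ.* ℕtoℚ k
ℕtoℚ-* zero k = sym (ℚP.*-zeroˡ (ℕtoℚ k))
ℕtoℚ-* (suc m) k rewrite ℕtoℚ-+ k (m ℕ.* k) | ℕtoℚ-* m k | ℕtoℚ-suc m =
  solve 2 (λ x y → y :+ x :* y := (con 1ℚ :+ x) :* y) refl (ℕtoℚ m) (ℕtoℚ k)

ℕtoℚ-^ : ∀ m k → ℕtoℚ (m ℕ.^ k) ≡ powℚ (ℕtoℚ m) k
ℕtoℚ-^ m zero = refl
ℕtoℚ-^ m (suc k) rewrite ℕtoℚ-* m (m ℕ.^ k) | ℕtoℚ-^ m k = refl

ℕtoℚ-nonNeg : ∀ m → 0ℚ ℚ.≤ ℕtoℚ m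
ℕtoℚ-nonNeg m rewrite ℕtoℚ-mkℚ m = ℚP.nonNegative⁻¹ _

ℕtoℚ-≥1 : ∀ {m} → 1 ≤ m → 1ℚ ℚ.≤ ℕtoℚ m
ℕtoℚ-≥1 {suc m} _ rewrite ℕtoℚ-suc m =
  ℚP.≤-trans (ℚP.≤-reflexive (sym (ℚP.+-identityʳ 1ℚ))) (ℚP.+-monoʳ-≤ 1ℚ (ℕtoℚ-nonNeg m))

sumL : List ℚ → ℚ
sumL = foldr ℚ._+_ 0ℚ

sumL-const : ∀ {A : Set} (xs : List A) c → sumL (map (λ _ → c) xs) ≡ ℕtoℚ (length xs) ℚ.* c
sumL-const [] c = sym (ℚP.*-zeroˡ c)
sumL-const (x ∷ xs) c rewrite sumL-const xs c | ℕtoℚ-suc (length xs) =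
  solve 2 (λ m c → c :+ m :* c := (con 1ℚ :+ m) :* c) refl (ℕtoℚ (length xs)) c

sumL-++ : ∀ xs ys → sumL (xs ++ ys) ≡ sumL xs ℚ.+ sumL ys
sumL-++ [] ys = sym (ℚP.+-identityˡ _)
sumL-++ (x ∷ xs) ys = trans (cong (x ℚ.+_) (sumL-++ xs ys)) (sym (ℚP.+-assoc x (sumL xs) (sumL ys)))

sumL-mono : ∀ {A : Set} (f g : A → ℚ) xs → (∀ {x} → x ∈ xs → f x ℚ.≤ g x) →
            sumL (map f xs) ℚ.≤ sumL (map g xs)
sumL-mono f g [] f≤g = ℚP.≤-refl
sumL-mono f g (x ∷ xs) f≤g = ℚP.+-mono-≤ (f≤g (here refl)) (sumL-mono f g xs (f≤g ∘ there))

ind : Bool → ℚ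
ind true = 1ℚ
ind false = 0ℚ

ind-nonNeg : ∀ b → 0ℚ ℚ.≤ ind b
ind-nonNeg true = ℚP.nonNegative⁻¹ 1ℚ
ind-nonNeg false = ℚP.≤-refl

ind-mono : ∀ {a b} → (a ≡ true → b ≡ true) → ind a ℚ.≤ ind b
ind-mono {false} {b} _ = ind-nonNeg b
ind-mono {true} a⇒b rewrite a⇒b refl = ℚP.≤-refl

ind-∨ : ∀ a b → ind (a ∨ b) ℚ.≤ ind a ℚ.+ ind b
ind-∨ true b = ℚP.≤-trans (ℚP.≤-reflexive (sym (ℚP.+-identityʳ 1ℚ))) (ℚP.+-monoʳ-≤ 1ℚ (ind-nonNeg b))
ind-∨ false b = ℚP.≤-reflexive (sym (ℚP.+-identityˡ _))

ind-any : ∀ {A : Set} (f : A → Bool) xs → ind (any f xs) ℚ.≤ sumL (map (ind ∘ f) xs)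
ind-any f [] = ℚP.≤-refl
ind-any f (x ∷ xs) = ℚP.≤-trans (ind-∨ (f x) (any f xs)) (ℚP.+-monoʳ-≤ (ind (f x)) (ind-any f xs))

*-nonNeg : ∀ {x y} → 0ℚ ℚ.≤ x → 0ℚ ℚ.≤ y → 0ℚ ℚ.≤ x ℚ.* y
*-nonNeg {x} {y} 0≤x 0≤y =
  ℚP.nonNegative⁻¹ _ {{ℚP.nonNeg*nonNeg⇒nonNeg x {{ℚ.nonNegative 0≤x}} y {{ℚ.nonNegative 0≤y}}}}

*-mono-≤ : ∀ {x x′ y y′} → 0ℚ ℚ.≤ x → 0ℚ ℚ.≤ y → x ℚ.≤ x′ → y ℚ.≤ y′ → x ℚ.* y ℚ.≤ x′ ℚ.* y′
*-mono-≤ {x} {x′} {y} {y′} 0≤x 0≤y x≤x′ y≤y′ =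
  ℚP.≤-trans (ℚP.*-monoˡ-≤-nonNeg x {{ℚ.nonNegative 0≤x}} y≤y′)
             (ℚP.*-monoʳ-≤-nonNeg y′ {{ℚ.nonNegative (ℚP.≤-trans 0≤y y≤y′)}} x≤x′)

pow-nonNeg : ∀ {x} k → 0ℚ ℚ.≤ x → 0ℚ ℚ.≤ powℚ x k
pow-nonNeg zero _ = ℚP.nonNegative⁻¹ 1ℚ
pow-nonNeg (suc k) 0≤x = *-nonNeg 0≤x (pow-nonNeg k 0≤x)

pow-pos : ∀ {x} k → 0ℚ ℚ.< x → 0ℚ ℚ.< powℚ x k
pow-pos zero _ = ℚP.positive⁻¹ 1ℚ
pow-pos {x} (suc k) 0<x =
  ℚP.positive⁻¹ _ {{ℚP.pos*pos⇒pos x {{ℚ.positive 0<x}} (powℚ x k) {{ℚ.positive (pow-pos k 0<x)}}}}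

pow-1 : ∀ x → powℚ x 1 ≡ x
pow-1 = ℚP.*-identityʳ

pow-+ : ∀ x k l → powℚ x (k ℕ.+ l) ≡ powℚ x k ℚ.* powℚ x l
pow-+ x zero l = sym (ℚP.*-identityˡ _)
pow-+ x (suc k) l rewrite pow-+ x k l = sym (ℚP.*-assoc x (powℚ x k) (powℚ x l))

pow-* : ∀ x k l → powℚ x (k ℕ.* l) ≡ powℚ (powℚ x l) k
pow-* x zero l = refl
pow-* x (suc k) l rewrite pow-+ x l (k ℕ.* l) | pow-* x k l = refl

pow-swap : ∀ x k l → powℚ (powℚ x l) k ≡ powℚ (powℚ x k) l
pow-swap x k l = trans (sym (pow-* x k l)) (trans (cong (powℚ x) (ℕP.*-comm k l)) (pow-* x l k))

pow-distrib-* : ∀ x y k → powℚ (x ℚ.* y) k ≡ powℚ x k ℚ.* powℚ y k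
pow-distrib-* x y zero = refl
pow-distrib-* x y (suc k) rewrite pow-distrib-* x y k =
  solve 4 (λ x y a b → (x :* y) :* (a :* b) := (x :* a) :* (y :* b)) refl x y (powℚ x k) (powℚ y k)

pow-mono : ∀ {x y} k → 0ℚ ℚ.≤ x → x ℚ.≤ y → powℚ x k ℚ.≤ powℚ y k
pow-mono zero _ _ = ℚP.≤-refl
pow-mono (suc k) 0≤x x≤y = *-mono-≤ 0≤x (pow-nonNeg k 0≤x) x≤y (pow-mono k 0≤x x≤y)

pow-≥1 : ∀ {x} k → 1ℚ ℚ.≤ x → 1ℚ ℚ.≤ powℚ x k
pow-≥1 zero _ = ℚP.≤-refl
pow-≥1 (suc k) 1≤x =
  *-mono-≤ (ℚP.nonNegative⁻¹ 1ℚ) (ℚP.nonNegative⁻¹ 1ℚ) 1≤x (pow-≥1 k 1≤x)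

pow-≤1 : ∀ {x} k → 0ℚ ℚ.≤ x → x ℚ.≤ 1ℚ → powℚ x k ℚ.≤ 1ℚ
pow-≤1 zero _ _ = ℚP.≤-refl
pow-≤1 (suc k) 0≤x x≤1 = *-mono-≤ 0≤x (pow-nonNeg k 0≤x) x≤1 (pow-≤1 k 0≤x x≤1)

pow-antitone : ∀ {x} k l → 0ℚ ℚ.≤ x → x ℚ.≤ 1ℚ → k ℕ.≤ l → powℚ x l ℚ.≤ powℚ x k
pow-antitone {x} k l 0≤x x≤1 k≤l rewrite sym (ℕP.m+[n∸m]≡n k≤l) | pow-+ x k (l ℕ.∸ k) =
  ℚP.≤-trans (ℚP.*-monoˡ-≤-nonNeg (powℚ x k) {{ℚ.nonNegative (pow-nonNeg k 0≤x)}} (pow-≤1 (l ℕ.∸ k) 0≤x x≤1))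
             (ℚP.≤-reflexive (ℚP.*-identityʳ _))

pow-strict : ∀ {x y} k → 0ℚ ℚ.≤ x → x ℚ.< y → powℚ x (suc k) ℚ.< powℚ y (suc k)
pow-strict {x} {y} k 0≤x x<y =
  ℚP.≤-<-trans (ℚP.*-monoˡ-≤-nonNeg x {{ℚ.nonNegative 0≤x}} (pow-mono k 0≤x (ℚP.<⇒≤ x<y)))
               (ℚP.*-monoˡ-<-pos (powℚ y k) {{ℚ.positive (pow-pos k (ℚP.≤-<-trans 0≤x x<y))}} x<y)

pow-cancel-≤ : ∀ {x y} k → 0ℚ ℚ.≤ y → powℚ x (suc k) ℚ.≤ powℚ y (suc k) → x ℚ.≤ y
pow-cancel-≤ {x} {y} k 0≤y xᵏ≤yᵏ with x ℚP.≤? y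
... | yes x≤y = x≤y
... | no x≰y = ⊥-elim (ℚP.<-irrefl refl (ℚP.<-≤-trans (pow-strict k 0≤y (ℚP.≰⇒> x≰y)) xᵏ≤yᵏ))

-- The binomial random subset.  𝔼 X h is the expectation of h(G) for a random sublist G
-- of X containing each element independently with probability p; it is defined by
-- conditioning on the first element, which makes every property below an induction on X.

module RandomSubset (p : ℚ) (0≤p : 0ℚ ℚ.≤ p) (p≤1 : p ℚ.≤ 1ℚ) where

  q : ℚ
  q = 1ℚ ℚ.- p

  0≤q : 0ℚ ℚ.≤ q
  0≤q = ℚP.≤-trans (ℚP.≤-reflexive (sym (ℚP.+-inverseʳ p))) (ℚP.+-monoˡ-≤ (ℚ.- p) p≤1)

  p+q≡1 : p ℚ.+ q ≡ 1ℚ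
  p+q≡1 = solve 1 (λ p → p :+ (con 1ℚ :- p) := con 1ℚ) refl p

  𝔼 : {A : Set} → List A → (List A → ℚ) → ℚ
  𝔼 [] h = h []
  𝔼 (x ∷ xs) h = p ℚ.* 𝔼 xs (λ G → h (x ∷ G)) ℚ.+ q ℚ.* 𝔼 xs h

  _⊆_ : {A : Set} → List A → List A → Set
  G ⊆ X = All (_∈ X) G

  𝔼-mono : ∀ {A : Set} (X : List A) (h g : List A → ℚ) →
           (∀ G → G ⊆ X → h G ℚ.≤ g G) → 𝔼 X h ℚ.≤ 𝔼 X g
  𝔼-mono [] h g h≤g = h≤g [] []
  𝔼-mono (x ∷ xs) h g h≤g =
    ℚP.+-mono-≤ (ℚP.*-monoˡ-≤-nonNeg p {{ℚ.nonNegative 0≤p}}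
                   (𝔼-mono xs _ _ (λ G G⊆ → h≤g (x ∷ G) (here refl ∷ All.map there G⊆))))
                (ℚP.*-monoˡ-≤-nonNeg q {{ℚ.nonNegative 0≤q}}
                   (𝔼-mono xs _ _ (λ G G⊆ → h≤g G (All.map there G⊆))))

  𝔼-+ : ∀ {A : Set} (X : List A) (h g : List A → ℚ) → 𝔼 X (λ G → h G ℚ.+ g G) ≡ 𝔼 X h ℚ.+ 𝔼 X g
  𝔼-+ [] h g = refl
  𝔼-+ (x ∷ xs) h g rewrite 𝔼-+ xs (λ G → h (x ∷ G)) (λ G → g (x ∷ G)) | 𝔼-+ xs h g =
    solve 6 (λ p q a b c d → p :* (a :+ b) :+ q :* (c :+ d) := (p :* a :+ q :* c) :+ (p :* b :+ q :* d)) refl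
      p q (𝔼 xs (λ G → h (x ∷ G))) (𝔼 xs (λ G → g (x ∷ G))) (𝔼 xs h) (𝔼 xs g)

  𝔼-0 : ∀ {A : Set} (X : List A) → 𝔼 X (λ _ → 0ℚ) ≡ 0ℚ
  𝔼-0 [] = refl
  𝔼-0 (x ∷ xs) rewrite 𝔼-0 xs = solve 2 (λ p q → p :* con 0ℚ :+ q :* con 0ℚ := con 0ℚ) refl p q

  𝔼-sumL : ∀ {A I : Set} (X : List A) (is : List I) (h : I → List A → ℚ) →
           𝔼 X (λ G → sumL (map (λ i → h i G) is)) ≡ sumL (map (λ i → 𝔼 X (h i)) is)
  𝔼-sumL X [] h = 𝔼-0 X
  𝔼-sumL X (i ∷ is) h = trans (𝔼-+ X (h i) _) (cong (𝔼 X (h i) ℚ.+_) (𝔼-sumL X is h))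

  weighted : ℕ → {A : Set} → (List A → Bool) → List A → ℚ
  weighted m b G = if b G then powℚ p (length G) ℚ.* powℚ q (m ℕ.∸ length G) else 0ℚ

  subsetsL-length : ∀ {A : Set} (X : List A) → All (λ G → length G ℕ.≤ length X) (subsetsL X)
  subsetsL-length [] = z≤n ∷ []
  subsetsL-length (x ∷ xs) =
    AllP.++⁺ (AllP.map⁺ (All.map s≤s (subsetsL-length xs))) (All.map ℕP.m≤n⇒m≤1+n (subsetsL-length xs))

  sum-weighted-∷ : ∀ {A : Set} m (b : List A → Bool) x L →
    sumL (map (weighted (suc m) b) (map (x ∷_) L)) ≡ p ℚ.* sumL (map (weighted m (b ∘ (x ∷_))) L)
  sum-weighted-∷ m b x [] = sym (ℚP.*-zeroʳ p)
  sum-weighted-∷ m b x (G ∷ L) rewrite sum-weighted-∷ m b x L with b (x ∷ G)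
  ... | true = solve 4 (λ p a c r → p :* a :* c :+ p :* r := p :* (a :* c :+ r)) refl
                 p (powℚ p (length G)) (powℚ q (m ℕ.∸ length G)) (sumL (map (weighted m (b ∘ (x ∷_))) L))
  ... | false = solve 2 (λ p r → con 0ℚ :+ p :* r := p :* (con 0ℚ :+ r)) refl
                 p (sumL (map (weighted m (b ∘ (x ∷_))) L))

  sum-weighted-grow : ∀ {A : Set} m (b : List A → Bool) L → All (λ G → length G ℕ.≤ m) L →
    sumL (map (weighted (suc m) b) L) ≡ q ℚ.* sumL (map (weighted m b) L)
  sum-weighted-grow m b [] [] = sym (ℚP.*-zeroʳ q)
  sum-weighted-grow m b (G ∷ L) (|G|≤m ∷ rest) rewrite sum-weighted-grow m b L rest with b G
  ... | true rewrite ℕP.+-∸-assoc 1 |G|≤m =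
        solve 4 (λ q a c r → a :* (q :* c) :+ q :* r := q :* (a :* c :+ r)) refl
          q (powℚ p (length G)) (powℚ q (m ℕ.∸ length G)) (sumL (map (weighted m b) L))
  ... | false = solve 2 (λ q r → con 0ℚ :+ q :* r := q :* (con 0ℚ :+ r)) refl q (sumL (map (weighted m b) L))

  subset-sum-≡-𝔼 : ∀ {A : Set} (X : List A) (b : List A → Bool) →
                   sumL (map (weighted (length X) b) (subsetsL X)) ≡ 𝔼 X (ind ∘ b)
  subset-sum-≡-𝔼 [] b with b []
  ... | true = refl
  ... | false = refl
  subset-sum-≡-𝔼 {A} (x ∷ xs) b = begin
      sumL (map (weighted m′ b) (map (x ∷_) Gs ++ Gs))
        ≡⟨ cong sumL (ListP.map-++ (weighted m′ b) (map (x ∷_) Gs) Gs) ⟩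
      sumL (map (weighted m′ b) (map (x ∷_) Gs) ++ map (weighted m′ b) Gs)
        ≡⟨ sumL-++ (map (weighted m′ b) (map (x ∷_) Gs)) (map (weighted m′ b) Gs) ⟩
      sumL (map (weighted m′ b) (map (x ∷_) Gs)) ℚ.+ sumL (map (weighted m′ b) Gs)
        ≡⟨ cong₂ ℚ._+_ (sum-weighted-∷ m b x Gs) (sum-weighted-grow m b Gs (subsetsL-length xs)) ⟩
      p ℚ.* sumL (map (weighted m (b ∘ (x ∷_))) Gs) ℚ.+ q ℚ.* sumL (map (weighted m b) Gs)
        ≡⟨ cong₂ (λ u v → p ℚ.* u ℚ.+ q ℚ.* v) (subset-sum-≡-𝔼 xs (b ∘ (x ∷_))) (subset-sum-≡-𝔼 xs b) ⟩
      𝔼 (x ∷ xs) (ind ∘ b) ∎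
    where
    open ≡-Reasoning
    m : ℕ
    m = length xs
    m′ : ℕ
    m′ = suc m
    Gs : List (List A)
    Gs = subsetsL xs

  module _ {n : ℕ} where

    open import Data.List.Membership.DecPropositional (_≟P_ {n}) using (_∈?_)

    without : Pair n → List (Pair n) → List (Pair n)
    without x = filter (λ t → ¬? (t ≟P x))

    allIn-∷-∈ : ∀ (x : Pair n) T G → allIn T (x ∷ G) ≡ allIn (without x T) G
    allIn-∷-∈ x [] G = refl
    allIn-∷-∈ x (t ∷ T) G with t ≟P x
    ... | yes refl rewrite ListP.filter-reject (λ t′ → ¬? (t′ ≟P t)) {x = t} {xs = T} (λ t≢t → t≢t refl)
                         | eqPair-refl t = allIn-∷-∈ t T G
    ... | no t≢x rewrite ListP.filter-accept (λ t′ → ¬? (t′ ≟P x)) {x = t} {xs = T} t≢x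
                       | eqPair-≢ t x t≢x = cong (memB t G ∧_) (allIn-∷-∈ x T G)

    allIn-∷-∉ : ∀ (x : Pair n) T G → x ∉ T → allIn T (x ∷ G) ≡ allIn T G
    allIn-∷-∉ x [] G _ = refl
    allIn-∷-∉ x (t ∷ T) G x∉ rewrite eqPair-≢ t x (λ t≡x → x∉ (here (sym t≡x))) =
      cong (memB t G ∧_) (allIn-∷-∉ x T G (x∉ ∘ there))

    allIn-missing : ∀ (x : Pair n) T G → x ∈ T → x ∉ G → allIn T G ≡ false
    allIn-missing x T G x∈T x∉G with allIn T G in eq
    ... | false = refl
    ... | true = ⊥-elim (x∉G (memB-∈ x G (all-elim (λ t → memB t G) T eq x∈T)))

    length-without : ∀ (x : Pair n) T → Unique T → x ∈ T → length T ≡ suc (length (without x T))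
    length-without x (t ∷ T) (t∉T AllPairs.∷ uT) x∈ with t ≟P x
    ... | yes refl rewrite ListP.filter-reject (λ t′ → ¬? (t′ ≟P t)) {x = t} {xs = T} (λ t≢t → t≢t refl)
                         | ListP.filter-all (λ t′ → ¬? (t′ ≟P t)) (All.map (λ t≢t′ t′≡t → t≢t′ (sym t′≡t)) t∉T) = refl
    ... | no t≢x rewrite ListP.filter-accept (λ t′ → ¬? (t′ ≟P x)) {x = t} {xs = T} t≢x =
      cong suc (length-without x T uT (tail x∈))
      where
      tail : x ∈ t ∷ T → x ∈ T
      tail (here x≡t) = ⊥-elim (t≢x (sym x≡t))
      tail (there x∈T) = x∈T

    𝔼-contains : ∀ (X T : List (Pair n)) → Unique X → Unique T →
                 𝔼 X (λ G → ind (allIn T G)) ℚ.≤ powℚ p (length T)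
    𝔼-contains [] [] _ _ = ℚP.≤-refl
    𝔼-contains [] (t ∷ T) _ _ = pow-nonNeg (length (t ∷ T)) 0≤p
    𝔼-contains (x ∷ xs) T (x∉xs AllPairs.∷ uX) uT with x ∈? T
    ... | yes x∈T = begin
        p ℚ.* 𝔼 xs (λ G → ind (allIn T (x ∷ G))) ℚ.+ q ℚ.* 𝔼 xs (λ G → ind (allIn T G))
          ≤⟨ ℚP.+-mono-≤ (ℚP.*-monoˡ-≤-nonNeg p {{ℚ.nonNegative 0≤p}} x-chosen)
                         (ℚP.*-monoˡ-≤-nonNeg q {{ℚ.nonNegative 0≤q}} x-missing) ⟩
        p ℚ.* powℚ p (length (without x T)) ℚ.+ q ℚ.* 0ℚ
          ≡⟨ trans (cong (powℚ p (suc (length (without x T))) ℚ.+_) (ℚP.*-zeroʳ q)) (ℚP.+-identityʳ _) ⟩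
        powℚ p (suc (length (without x T)))
          ≡⟨ cong (powℚ p) (sym (length-without x T uT x∈T)) ⟩
        powℚ p (length T) ∎
      where
      open ℚP.≤-Reasoning
      x-chosen : 𝔼 xs (λ G → ind (allIn T (x ∷ G))) ℚ.≤ powℚ p (length (without x T))
      x-chosen = ℚP.≤-trans (𝔼-mono xs _ _ (λ G _ → ℚP.≤-reflexive (cong ind (allIn-∷-∈ x T G))))
                            (𝔼-contains xs (without x T) uX (Unique.filter⁺ (λ t → ¬? (t ≟P x)) uT))
      x-missing : 𝔼 xs (λ G → ind (allIn T G)) ℚ.≤ 0ℚ
      x-missing = ℚP.≤-trans (𝔼-mono xs _ (λ _ → 0ℚ) (λ G G⊆xs → ℚP.≤-reflexive (cong ind
                    (allIn-missing x T G x∈T (λ x∈G → All.lookup x∉xs (All.lookup G⊆xs x∈G) refl)))))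
                    (ℚP.≤-reflexive (𝔼-0 xs))
    ... | no x∉T = begin
        p ℚ.* 𝔼 xs (λ G → ind (allIn T (x ∷ G))) ℚ.+ q ℚ.* 𝔼 xs (λ G → ind (allIn T G))
          ≤⟨ ℚP.+-monoˡ-≤ _ (ℚP.*-monoˡ-≤-nonNeg p {{ℚ.nonNegative 0≤p}}
               (𝔼-mono xs _ _ (λ G _ → ℚP.≤-reflexive (cong ind (allIn-∷-∉ x T G x∉T))))) ⟩
        p ℚ.* 𝔼 xs (λ G → ind (allIn T G)) ℚ.+ q ℚ.* 𝔼 xs (λ G → ind (allIn T G))
          ≡⟨ trans (sym (ℚP.*-distribʳ-+ P[T⊆G] p q)) (trans (cong (ℚ._* P[T⊆G]) p+q≡1) (ℚP.*-identityˡ P[T⊆G])) ⟩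
        𝔼 xs (λ G → ind (allIn T G))
          ≤⟨ 𝔼-contains xs T uX uT ⟩
        powℚ p (length T) ∎
      where
      open ℚP.≤-Reasoning
      P[T⊆G] : ℚ
      P[T⊆G] = 𝔼 xs (λ G → ind (allIn T G))

-- The H-bootstrap process: it can only leave G if some pair is triggered at time 0,
-- since triggering is monotone in the current graph and the process only adds edges.

module Bootstrap {n : ℕ} (H : Graph) where

  triggered-mono : ∀ (G G′ : List (Pair n)) e → (∀ f → memB f G′ ≡ true → memB f G ≡ true) →
                   triggered H G′ e ≡ true → triggered H G e ≡ true
  triggered-mono G G′ e G′⊆G trig with any-witness _ (allVecs n (V H)) trig
  ... | φ , φ∈ , ok with ∧-split {injB φ} ok
  ... | inj , rest with ∧-split {memB e (copyEdges H φ)} rest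
  ... | e∈copy , copy⊆G′+e =
    any-intro _ (allVecs n (V H)) φ∈ (∧-join {injB φ} inj (∧-join {memB e (copyEdges H φ)} e∈copy copy⊆G+e))
    where
    copy⊆G+e : all (λ f → memB f G ∨ eqPair f e) (copyEdges H φ) ≡ true
    copy⊆G+e = all-intro _ (copyEdges H φ) λ {f} f∈ →
      [ (λ f∈G′ → ∨-inl (eqPair f e) (G′⊆G f f∈G′)) , ∨-inr (memB f G) ]′
        (∨-split {memB f G′} (all-elim _ (copyEdges H φ) copy⊆G′+e f∈))

  stationary : ∀ (G : List (Pair n)) → (∀ e → e ∈ pairs n → triggered H G e ≡ false) →
               ∀ t f → memB f (iterG H t G) ≡ true → memB f G ≡ true
  stationary G inert zero f f∈ = f∈
  stationary G inert (suc t) f f∈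
    with ∈-filter⁻ (λ e → memB e (iterG H t G) ∨ triggered H (iterG H t G) e Bool.≟ true)
                   {xs = pairs n} (memB-∈ f _ f∈)
  ... | f∈pairs , added with ∨-split added
  ... | inj₁ f∈Gₜ = stationary G inert t f f∈Gₜ
  ... | inj₂ trig with trans (sym (inert f f∈pairs)) (triggered-mono G (iterG H t G) f (stationary G inert t) trig)
  ... | ()

  percolates-split : ∀ (G : List (Pair n)) → percolates H G ≡ true →
                     allIn (pairs n) G ≡ true ⊎ ∃ λ e → triggered H G e ≡ true
  percolates-split G perc with any (triggered H G) (pairs n) in some
  ... | true = inj₂ (let (e , _ , trig) = any-witness _ (pairs n) some in e , trig)
  ... | false = inj₁ (all-intro _ (pairs n) λ {e} e∈ →
                  stationary G inert (length (pairs n)) e (all-elim _ (pairs n) perc e∈))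
    where
    inert : ∀ e → e ∈ pairs n → triggered H G e ≡ false
    inert e e∈ with triggered H G e in trig
    ... | false = refl
    ... | true = case trans (sym some) (any-intro _ (pairs n) e∈ trig) of λ ()

-- To count copies of a subgraph F of H we only record where
-- the vertices of F go: every other vertex is sent to a fixed vertex d, so a vertex set
-- S admits exactly n^|S| such "restricted" maps.

injective-from-ordered : ∀ {k} {A : Set} (f : Fin k → A) (S : Fin k → Set) →
  (∀ {i j} → i Fin.< j → S i → S j → f i ≢ f j) → ∀ {i j} → S i → S j → f i ≡ f j → i ≡ j
injective-from-ordered f S inj {i} {j} Si Sj fi≡fj with FinP.<-cmp i j
... | tri< i<j _ _ = ⊥-elim (inj i<j Si Sj fi≡fj)
... | tri≈ _ i≡j _ = i≡j
... | tri> _ _ j<i = ⊥-elim (inj j<i Sj Si (sym fi≡fj))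

distinct-≢ : ∀ {m} {a b : Fin m} → not (does (a Fin.≟ b)) ≡ true → a ≢ b
distinct-≢ {a = a} {b} ne a≡b = case trans (sym ne) (cong not (dec-true (a Fin.≟ b) a≡b)) of λ ()

injB-sound : ∀ {n k} (φ : Vec (Fin n) k) → injB φ ≡ true → ∀ {i j} → lookup φ i ≡ lookup φ j → i ≡ j
injB-sound {k = k} φ inj = injective-from-ordered (lookup φ) (λ _ → ⊤)
  (λ i<j _ _ → distinct-≢ (all-elim _ (pairs k) inj (∈-pairs i<j))) tt tt

size : (k : ℕ) → (Fin k → Bool) → ℕ
size zero S = 0
size (suc k) S = (if S Fin.zero then 1 else 0) ℕ.+ size k (S ∘ Fin.suc)

countB-tabulate : ∀ {A : Set} k (f : Fin k → A) (S : A → Bool) → countB S (List.tabulate f) ≡ size k (S ∘ f)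
countB-tabulate zero f S = refl
countB-tabulate (suc k) f S with S (f Fin.zero)
... | true = cong suc (countB-tabulate k (f ∘ Fin.suc) S)
... | false = countB-tabulate k (f ∘ Fin.suc) S

length-prefixes : ∀ {A : Set} {m} (C : List A) (R : List (Vec A m)) →
                  length (concatMap (λ x → map (x ∷_) R) C) ≡ length C ℕ.* length R
length-prefixes [] R = refl
length-prefixes (x ∷ C) R =
  trans (ListP.length-++ (map (x ∷_) R)) (cong₂ ℕ._+_ (ListP.length-map _ R) (length-prefixes C R))

module Maps {n : ℕ} (d : Fin n) where

  injectiveOn : ∀ {k} → (Fin k → Bool) → Vec (Fin n) k → Bool
  injectiveOn {k} S ψ =
    all (λ (i , j) → not (S i ∧ S j ∧ does (lookup ψ i Fin.≟ lookup ψ j))) (pairs k)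

  injectiveOn-sound : ∀ {k} (S : Fin k → Bool) ψ → injectiveOn S ψ ≡ true →
                      ∀ {i j} → S i ≡ true → S j ≡ true → lookup ψ i ≡ lookup ψ j → i ≡ j
  injectiveOn-sound {k} S ψ inj = injective-from-ordered (lookup ψ) (λ i → S i ≡ true)
    λ {i} {j} i<j Si Sj → distinct-≢ (on-S Si Sj (all-elim _ (pairs k) inj (∈-pairs i<j)))
    where
    on-S : ∀ {x y b} → x ≡ true → y ≡ true → not (x ∧ y ∧ b) ≡ true → not b ≡ true
    on-S refl refl ok = ok

  restrict : ∀ {k} → (Fin k → Bool) → Vec (Fin n) k → Vec (Fin n) k
  restrict S [] = []
  restrict S (x ∷ φ) = (if S Fin.zero then x else d) ∷ restrict (S ∘ Fin.suc) φ

  restrict-lookup : ∀ {k} (S : Fin k → Bool) φ i → S i ≡ true → lookup (restrict S φ) i ≡ lookup φ i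
  restrict-lookup S (x ∷ φ) Fin.zero Si rewrite Si = refl
  restrict-lookup S (x ∷ φ) (Fin.suc i) Si = restrict-lookup (S ∘ Fin.suc) φ i Si

  injectiveOn-restrict : ∀ {k} (S : Fin k → Bool) φ → injB φ ≡ true → injectiveOn S (restrict S φ) ≡ true
  injectiveOn-restrict {k} S φ inj = all-intro _ (pairs k) λ { {i , j} ij∈ → distinct (pairs-ordered ij∈) }
    where
    distinct : ∀ {i j} → i Fin.< j → not (S i ∧ S j ∧ does (lookup (restrict S φ) i Fin.≟ lookup (restrict S φ) j)) ≡ true
    distinct {i} {j} i<j with S i in Si | S j in Sj
    ... | false | _ = refl
    ... | true | false = refl
    ... | true | true rewrite restrict-lookup S φ i Si | restrict-lookup S φ j Sj =
      cong not (dec-false (lookup φ i Fin.≟ lookup φ j) (FinP.<⇒≢ i<j ∘ injB-sound φ inj))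

  restrictedMaps : (k : ℕ) → (Fin k → Bool) → List (Vec (Fin n) k)
  restrictedMaps zero S = [] ∷ []
  restrictedMaps (suc k) S = concatMap (λ x → map (x ∷_) (restrictedMaps k (S ∘ Fin.suc))) (images (S Fin.zero))
    where
    images : Bool → List (Fin n)
    images true = allFin n
    images false = d ∷ []

  restrict-∈ : ∀ {k} (S : Fin k → Bool) φ → restrict S φ ∈ restrictedMaps k S
  restrict-∈ S [] = here refl
  restrict-∈ S (x ∷ φ) with S Fin.zero
  ... | true = ∈-concat⁺′ (∈-map⁺ (x ∷_) (restrict-∈ (S ∘ Fin.suc) φ)) (∈-map⁺ _ (∈-allFin x))
  ... | false = ∈-concat⁺′ {xss = map (d ∷_) (restrictedMaps _ (S ∘ Fin.suc)) ∷ []} (∈-map⁺ (d ∷_) (restrict-∈ (S ∘ Fin.suc) φ)) (here refl)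

  length-restrictedMaps : ∀ k (S : Fin k → Bool) → length (restrictedMaps k S) ≡ n ℕ.^ size k S
  length-restrictedMaps zero S = refl
  length-restrictedMaps (suc k) S with S Fin.zero
  ... | true = trans (length-prefixes (allFin n) (restrictedMaps k (S ∘ Fin.suc)))
                     (cong₂ ℕ._*_ (ListP.length-tabulate {n = n} (λ x → x)) (length-restrictedMaps k (S ∘ Fin.suc)))
  ... | false = trans (length-prefixes (d ∷ []) (restrictedMaps k (S ∘ Fin.suc)))
                      (trans (ℕP.+-identityʳ _) (length-restrictedMaps k (S ∘ Fin.suc)))

module Copies {n : ℕ} (H : Graph) (d : Fin n) where
  open Maps d

  module _ {ε : Pair (V H)} (F : SubgraphMinus H ε) where
    open SubgraphMinus F

    edgesF : List (Pair (V H))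
    edgesF = filter (λ (i , j) → A i j Bool.≟ true) (pairs (V H))

    edgesF-spec : ∀ {i j} → (i , j) ∈ edgesF → i Fin.< j × A i j ≡ true
    edgesF-spec ij∈ with ∈-filter⁻ (λ (i , j) → A i j Bool.≟ true) {xs = pairs (V H)} ij∈
    ... | ij∈pairs , Aij = pairs-ordered ij∈pairs , Aij

    image : Vec (Fin n) (V H) → List (Pair n)
    image ψ = map (λ (i , j) → norm (lookup ψ i) (lookup ψ j)) edgesF

    copyEvent : Vec (Fin n) (V H) → List (Pair n) → Bool
    copyEvent ψ G = injectiveOn S ψ ∧ allIn (image ψ) G

    length-image : ∀ ψ → length (image ψ) ≡ eF F
    length-image ψ = ListP.length-map _ edgesF

    image-unique : ∀ ψ → injectiveOn S ψ ≡ true → Unique (image ψ)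
    image-unique ψ inj = map-injectiveOn (Unique.filter⁺ _ pairs-unique) (All.tabulate edge-on-S)
      where
      inj-S : ∀ {i j} → S i ≡ true → S j ≡ true → lookup ψ i ≡ lookup ψ j → i ≡ j
      inj-S = injectiveOn-sound S ψ inj
      OnS : Pair (V H) → Set
      OnS (i , j) = i Fin.< j × S i ≡ true × S j ≡ true
      edge-on-S : ∀ {x} → x ∈ edgesF → OnS x
      edge-on-S {i , j} ij∈ with edgesF-spec ij∈
      ... | i<j , Aij with A⊆ i j i<j Aij
      ... | _ , Si , Sj , _ = i<j , Si , Sj
      norm-ψ-inj : ∀ {x y} → OnS x → OnS y → norm (lookup ψ (proj₁ x)) (lookup ψ (proj₂ x))
                   ≡ norm (lookup ψ (proj₁ y)) (lookup ψ (proj₂ y)) → x ≡ y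
      norm-ψ-inj (i<j , Si , Sj) (k<l , Sk , Sl) eq with norm-inj _ _ _ _ eq
      ... | inj₁ (ψi≡ψk , ψj≡ψl) = cong₂ _,_ (inj-S Si Sk ψi≡ψk) (inj-S Sj Sl ψj≡ψl)
      ... | inj₂ (ψi≡ψl , ψj≡ψk) with inj-S Si Sl ψi≡ψl | inj-S Sj Sk ψj≡ψk
      ... | refl | refl = ⊥-elim (FinP.<-asym i<j k<l)
      map-injectiveOn : ∀ {xs} → Unique xs → All OnS xs → Unique (map (λ (i , j) → norm (lookup ψ i) (lookup ψ j)) xs)
      map-injectiveOn AllPairs.[] [] = AllPairs.[]
      map-injectiveOn (x∉xs AllPairs.∷ u) (Sx ∷ Sxs) =
        AllP.map⁺ (All.tabulate (λ y∈ eq → All.lookup x∉xs y∈ (norm-ψ-inj Sx (All.lookup Sxs y∈) eq)))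
        AllPairs.∷ map-injectiveOn u Sxs

  norm-injective : ∀ (φ : Vec (Fin n) (V H)) → injB φ ≡ true → ∀ {a b i j} → a Fin.< b → i Fin.< j →
                   (a , b) ≢ (i , j) → norm (lookup φ a) (lookup φ b) ≢ norm (lookup φ i) (lookup φ j)
  norm-injective φ inj a<b i<j ab≢ij eq with norm-inj _ _ _ _ eq
  ... | inj₁ (φa≡φi , φb≡φj) = ab≢ij (cong₂ _,_ (injB-sound φ inj φa≡φi) (injB-sound φ inj φb≡φj))
  ... | inj₂ (φa≡φj , φb≡φi) with injB-sound φ inj φa≡φj | injB-sound φ inj φb≡φi
  ... | refl | refl = FinP.<-asym a<b i<j

  triggered⇒copies : ∀ (G : List (Pair n)) e → triggered H G e ≡ true →
    ∃ λ ε → IsEdge H ε × ∃ λ φ → ∀ (F : SubgraphMinus H ε) → copyEvent F (restrict (SubgraphMinus.S F) φ) G ≡ true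
  triggered⇒copies G e trig with any-witness _ (allVecs n (V H)) trig
  ... | φ , _ , ok with ∧-split {injB φ} ok
  ... | inj , rest with ∧-split {memB e (copyEdges H φ)} rest
  ... | e∈copy , copy⊆G+e with ∈-map⁻ _ (memB-∈ e (copyEdges H φ) e∈copy)
  ... | (i , j) , ij∈edgesH , refl with ∈-filter⁻ (λ (i , j) → adj H i j Bool.≟ true) {xs = pairs (V H)} ij∈edgesH
  ... | ij∈pairs , adj-ij = (i , j) , (i<j , adj-ij) , φ , λ F →
        ∧-join {injectiveOn (SubgraphMinus.S F) (restrict (SubgraphMinus.S F) φ)}
               (injectiveOn-restrict (SubgraphMinus.S F) φ inj) (image⊆G F)
    where
    i<j : i Fin.< j
    i<j = pairs-ordered ij∈pairs
    image⊆G : (F : SubgraphMinus H (i , j)) → allIn (image F (restrict (SubgraphMinus.S F) φ)) G ≡ true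
    image⊆G F = all-intro _ (image F ψ) λ f∈ → edge-in-G f∈
      where
      open SubgraphMinus F
      ψ : Vec (Fin n) (V H)
      ψ = restrict S φ
      edge-in-G : ∀ {f} → f ∈ image F ψ → memB f G ≡ true
      edge-in-G f∈ with ∈-map⁻ _ f∈
      ... | (a , b) , ab∈F , refl with edgesF-spec F ab∈F
      ... | a<b , Aab with A⊆ a b a<b Aab
      ... | adj-ab , Sa , Sb , ab≢ij rewrite restrict-lookup S φ a Sa | restrict-lookup S φ b Sb =
        [ (λ in-G → in-G) , (λ is-e → ⊥-elim (norm-injective φ inj a<b i<j ab≢ij (eqPair-≡ _ _ is-e))) ]′
          (∨-split (all-elim _ (copyEdges H φ) copy⊆G+e
            (∈-map⁺ _ (∈-filter⁺ (λ (i , j) → adj H i j Bool.≟ true) (∈-pairs a<b) adj-ab))))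

  anyCopy : ∀ {ε} → SubgraphMinus H ε → List (Pair n) → Bool
  anyCopy F G = any (λ ψ → copyEvent F ψ G) (restrictedMaps (V H) (SubgraphMinus.S F))

module FirstMoment {n : ℕ} (H : Graph) (d : Fin n) (p : ℚ) (0≤p : 0ℚ ℚ.≤ p) (p≤1 : p ℚ.≤ 1ℚ)
                   (choose : ∀ ε → IsEdge H ε → SubgraphMinus H ε) where
  open RandomSubset p 0≤p p≤1
  open Maps d
  open Copies H d
  open Bootstrap {n} H

  isEdge? : (ε : Pair (V H)) → Dec (IsEdge H ε)
  isEdge? (i , j) = (i Fin.<? j) ×-dec (adj H i j Bool.≟ true)

  containsCopy : Pair (V H) → List (Pair n) → Bool
  containsCopy ε G with isEdge? ε
  ... | yes ε-edge = anyCopy (choose ε ε-edge) G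
  ... | no _ = false

  percolates⇒complete-or-copy : ∀ G → percolates H G ≡ true →
    allIn (pairs n) G ∨ any (λ ε → containsCopy ε G) (pairs (V H)) ≡ true
  percolates⇒complete-or-copy G perc with percolates-split G perc
  ... | inj₁ complete = ∨-inl _ complete
  ... | inj₂ (e , trig) with triggered⇒copies G e trig
  ... | ε , ε-edge , φ , embeds = ∨-inr (allIn (pairs n) G)
        (any-intro _ (pairs (V H)) (∈-pairs (proj₁ ε-edge)) copy-of-Fε)
    where
    copy-of-Fε : containsCopy ε G ≡ true
    copy-of-Fε with isEdge? ε
    ... | yes ε-edge′ = any-intro _ (restrictedMaps (V H) _) (restrict-∈ _ φ) (embeds (choose ε ε-edge′))
    ... | no ¬edge = ⊥-elim (¬edge ε-edge)

  copy-probability : ∀ {ε} (F : SubgraphMinus H ε) ψ →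
                     𝔼 (pairs n) (ind ∘ copyEvent F ψ) ℚ.≤ powℚ p (eF F)
  copy-probability F ψ with injectiveOn (SubgraphMinus.S F) ψ in inj
  ... | false = ℚP.≤-trans (ℚP.≤-reflexive (𝔼-0 (pairs n))) (pow-nonNeg (eF F) 0≤p)
  ... | true = subst (λ k → 𝔼 (pairs n) (λ G → ind (allIn (image F ψ) G)) ℚ.≤ powℚ p k) (length-image F ψ)
                 (𝔼-contains (pairs n) (image F ψ) pairs-unique (image-unique F ψ inj))

  anyCopy-probability : ∀ {ε} (F : SubgraphMinus H ε) →
                        𝔼 (pairs n) (ind ∘ anyCopy F) ℚ.≤ powℚ (ℕtoℚ n) (vF F) ℚ.* powℚ p (eF F)
  anyCopy-probability F = begin
      𝔼 (pairs n) (ind ∘ anyCopy F)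
        ≤⟨ 𝔼-mono (pairs n) _ _ (λ G _ → ind-any (λ ψ → copyEvent F ψ G) Ψ) ⟩
      𝔼 (pairs n) (λ G → sumL (map (λ ψ → ind (copyEvent F ψ G)) Ψ))
        ≡⟨ 𝔼-sumL (pairs n) Ψ (λ ψ → ind ∘ copyEvent F ψ) ⟩
      sumL (map (λ ψ → 𝔼 (pairs n) (ind ∘ copyEvent F ψ)) Ψ)
        ≤⟨ sumL-mono _ _ Ψ (λ {ψ} _ → copy-probability F ψ) ⟩
      sumL (map (λ _ → powℚ p (eF F)) Ψ)
        ≡⟨ sumL-const Ψ _ ⟩
      ℕtoℚ (length Ψ) ℚ.* powℚ p (eF F)
        ≡⟨ cong (λ m → ℕtoℚ m ℚ.* powℚ p (eF F)) |Ψ|≡n^v ⟩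
      ℕtoℚ (n ℕ.^ vF F) ℚ.* powℚ p (eF F)
        ≡⟨ cong (ℚ._* powℚ p (eF F)) (ℕtoℚ-^ n (vF F)) ⟩
      powℚ (ℕtoℚ n) (vF F) ℚ.* powℚ p (eF F) ∎
    where
    open ℚP.≤-Reasoning
    S : Fin (V H) → Bool
    S = SubgraphMinus.S F
    Ψ : List (Vec (Fin n) (V H))
    Ψ = restrictedMaps (V H) S
    |Ψ|≡n^v : length Ψ ≡ n ℕ.^ vF F
    |Ψ|≡n^v = trans (length-restrictedMaps (V H) S) (cong (n ℕ.^_) (sym (countB-tabulate (V H) (λ i → i) S)))

  first-moment-bound : (δ : ℚ) → 0ℚ ℚ.≤ δ →
    (∀ ε (ε-edge : IsEdge H ε) → powℚ (ℕtoℚ n) (vF (choose ε ε-edge)) ℚ.* powℚ p (eF (choose ε ε-edge)) ℚ.≤ δ) →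
    probPerc n H p ℚ.≤ powℚ p (length (pairs n)) ℚ.+ sumL (map (λ _ → δ) (pairs (V H)))
  first-moment-bound δ 0≤δ small = begin
      probPerc n H p
        ≡⟨ subset-sum-≡-𝔼 (pairs n) (percolates H) ⟩
      𝔼 (pairs n) (ind ∘ percolates H)
        ≤⟨ 𝔼-mono (pairs n) _ _ (λ G _ → union-bound G) ⟩
      𝔼 (pairs n) (λ G → ind (allIn (pairs n) G) ℚ.+ sumL (map (λ ε → ind (containsCopy ε G)) (pairs (V H))))
        ≡⟨ 𝔼-+ (pairs n) _ _ ⟩
      𝔼 (pairs n) (ind ∘ allIn (pairs n)) ℚ.+ 𝔼 (pairs n) (λ G → sumL (map (λ ε → ind (containsCopy ε G)) (pairs (V H))))
        ≡⟨ cong (𝔼 (pairs n) (ind ∘ allIn (pairs n)) ℚ.+_) (𝔼-sumL (pairs n) (pairs (V H)) (λ ε → ind ∘ containsCopy ε)) ⟩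
      𝔼 (pairs n) (ind ∘ allIn (pairs n)) ℚ.+ sumL (map (λ ε → 𝔼 (pairs n) (ind ∘ containsCopy ε)) (pairs (V H)))
        ≤⟨ ℚP.+-mono-≤ (𝔼-contains (pairs n) (pairs n) pairs-unique pairs-unique)
                       (sumL-mono _ _ (pairs (V H)) (λ {ε} _ → containsCopy-probability ε)) ⟩
      powℚ p (length (pairs n)) ℚ.+ sumL (map (λ _ → δ) (pairs (V H))) ∎
    where
    open ℚP.≤-Reasoning
    union-bound : ∀ G → ind (percolates H G) ℚ.≤
                  ind (allIn (pairs n) G) ℚ.+ sumL (map (λ ε → ind (containsCopy ε G)) (pairs (V H)))
    union-bound G = ℚP.≤-trans (ind-mono (percolates⇒complete-or-copy G))
                      (ℚP.≤-trans (ind-∨ (allIn (pairs n) G) _)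
                                  (ℚP.+-monoʳ-≤ (ind (allIn (pairs n) G)) (ind-any (λ ε → containsCopy ε G) (pairs (V H)))))
    containsCopy-probability : ∀ ε → 𝔼 (pairs n) (ind ∘ containsCopy ε) ℚ.≤ δ
    containsCopy-probability ε with isEdge? ε
    ... | yes ε-edge = ℚP.≤-trans (anyCopy-probability (choose ε ε-edge)) (small ε ε-edge)
    ... | no _ = ℚP.≤-trans (ℚP.≤-reflexive (𝔼-0 (pairs n))) 0≤δ

-- Exponent arithmetic.  With c = δ^b, the hypothesis p^a x^b ≤ c^a (x = n) says
-- p ≤ c · x^(-b/a); for a subgraph of density e/v ≥ a/b this makes n^v p^e ≤ δ.

density-bound : ∀ (x p δ : ℚ) (a′ b′ v e : ℕ) → 0ℚ ℚ.≤ x → 0ℚ ℚ.≤ p → p ℚ.≤ 1ℚ → 0ℚ ℚ.≤ δ → δ ℚ.≤ 1ℚ →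
  1 ≤ v → suc a′ ℕ.* v ≤ e ℕ.* suc b′ →
  powℚ p (suc a′) ℚ.* powℚ x (suc b′) ℚ.≤ powℚ (powℚ δ (suc b′)) (suc a′) →
  powℚ x v ℚ.* powℚ p e ℚ.≤ δ
density-bound x p δ a′ b′ v e 0≤x 0≤p p≤1 0≤δ δ≤1 1≤v av≤eb hyp = pow-cancel-≤ b′ 0≤δ (begin
    powℚ (powℚ x v ℚ.* powℚ p e) b
      ≡⟨ pow-distrib-* (powℚ x v) (powℚ p e) b ⟩
    powℚ (powℚ x v) b ℚ.* powℚ (powℚ p e) b
      ≡⟨ cong₂ ℚ._*_ (pow-swap x b v) (sym (pow-* p b e)) ⟩
    powℚ (powℚ x b) v ℚ.* powℚ p (b ℕ.* e)
      ≤⟨ ℚP.*-monoˡ-≤-nonNeg (powℚ (powℚ x b) v) {{ℚ.nonNegative (pow-nonNeg v (pow-nonNeg b 0≤x))}}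
           (pow-antitone (a ℕ.* v) (b ℕ.* e) 0≤p p≤1 (ℕP.≤-trans av≤eb (ℕP.≤-reflexive (ℕP.*-comm e b)))) ⟩
    powℚ (powℚ x b) v ℚ.* powℚ p (a ℕ.* v)
      ≡⟨ cong (powℚ (powℚ x b) v ℚ.*_) (trans (cong (powℚ p) (ℕP.*-comm a v)) (pow-* p v a)) ⟩
    powℚ (powℚ x b) v ℚ.* powℚ (powℚ p a) v
      ≡⟨ sym (pow-distrib-* (powℚ x b) (powℚ p a) v) ⟩
    powℚ (powℚ x b ℚ.* powℚ p a) v
      ≤⟨ pow-mono v (*-nonNeg (pow-nonNeg b 0≤x) (pow-nonNeg a 0≤p)) (ℚP.≤-trans (ℚP.≤-reflexive (ℚP.*-comm (powℚ x b) (powℚ p a))) hyp) ⟩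
    powℚ cᵃ v
      ≤⟨ ℚP.≤-trans (pow-antitone 1 v (pow-nonNeg a 0≤c) (pow-≤1 a 0≤c c≤1) 1≤v) (ℚP.≤-reflexive (pow-1 cᵃ)) ⟩
    cᵃ
      ≤⟨ ℚP.≤-trans (pow-antitone 1 a 0≤c c≤1 (s≤s z≤n)) (ℚP.≤-reflexive (pow-1 c)) ⟩
    powℚ δ b ∎)
  where
  open ℚP.≤-Reasoning
  a : ℕ
  a = suc a′
  b : ℕ
  b = suc b′
  c : ℚ
  c = powℚ δ b
  cᵃ : ℚ
  cᵃ = powℚ c a
  0≤c : 0ℚ ℚ.≤ c
  0≤c = pow-nonNeg b 0≤δ
  c≤1 : c ℚ.≤ 1ℚ
  c≤1 = pow-≤1 b 0≤δ δ≤1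

p≤δ : ∀ (p x δ : ℚ) a′ b′ → 0ℚ ℚ.≤ p → 0ℚ ℚ.≤ δ → δ ℚ.≤ 1ℚ → 1ℚ ℚ.≤ x →
      powℚ p (suc a′) ℚ.* powℚ x (suc b′) < powℚ (powℚ δ (suc b′)) (suc a′) → p ℚ.≤ δ
p≤δ p x δ a′ b′ 0≤p 0≤δ δ≤1 1≤x hyp = ℚP.≤-trans p≤c c≤δ
  where
  c : ℚ
  c = powℚ δ (suc b′)
  pᵃ≤pᵃxᵇ : powℚ p (suc a′) ℚ.≤ powℚ p (suc a′) ℚ.* powℚ x (suc b′)
  pᵃ≤pᵃxᵇ = ℚP.≤-trans (ℚP.≤-reflexive (sym (ℚP.*-identityʳ _)))
              (ℚP.*-monoˡ-≤-nonNeg (powℚ p (suc a′)) {{ℚ.nonNegative (pow-nonNeg (suc a′) 0≤p)}} (pow-≥1 (suc b′) 1≤x))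
  p≤c : p ℚ.≤ c
  p≤c = pow-cancel-≤ a′ (pow-nonNeg (suc b′) 0≤δ) (ℚP.<⇒≤ (ℚP.≤-<-trans pᵃ≤pᵃxᵇ hyp))
  c≤δ : c ℚ.≤ δ
  c≤δ = ℚP.≤-trans (pow-antitone 1 (suc b′) 0≤δ δ≤1 (s≤s z≤n)) (ℚP.≤-reflexive (pow-1 δ))

zero-exponent-impossible : ∀ (p x c : ℚ) b → 1ℚ ℚ.≤ x → ¬ (powℚ p 0 ℚ.* powℚ x b < powℚ c 0)
zero-exponent-impossible p x c b 1≤x hyp =
  ℚP.<-irrefl refl (ℚP.≤-<-trans (ℚP.≤-trans (pow-≥1 b 1≤x) (ℚP.≤-reflexive (sym (ℚP.*-identityˡ _)))) hyp)

-- δ = 1/(4(E+1)), so that E + 1 terms of size δ add up to 1/4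
module Budget (E : ℕ) where

  E+1 : ℚ
  E+1 = mkℚ (+ suc E) 0 (Coprime.sym (Coprime.1-coprimeTo (suc E)))

  ¼ : ℚ
  ¼ = ½ ℚ.* ½

  δ : ℚ
  δ = ¼ ℚ.* ℚ.1/ E+1

  0<δ : 0ℚ < δ
  0<δ = ℚP.positive⁻¹ δ {{ℚP.pos*pos⇒pos ¼ (ℚ.1/ E+1)}}

  1/[E+1]≤1 : ℚ.1/ E+1 ℚ.≤ 1ℚ
  1/[E+1]≤1 = ℚ.*≤* (ℤ.+≤+ (s≤s z≤n))

  δ≤1 : δ ℚ.≤ 1ℚ
  δ≤1 = ℚP.≤-trans (*-mono-≤ (ℚP.nonNegative⁻¹ ¼) (ℚP.nonNegative⁻¹ (ℚ.1/ E+1))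
                              (toWitness {a? = ¼ ℚP.≤? 1ℚ} _) 1/[E+1]≤1)
                   (ℚP.≤-reflexive (ℚP.*-identityˡ 1ℚ))

  budget : ∀ {A : Set} (xs : List A) → length xs ≡ E → δ ℚ.+ sumL (map (λ _ → δ) xs) ≡ ¼
  budget xs refl = begin
      δ ℚ.+ sumL (map (λ _ → δ) xs)          ≡⟨ cong (δ ℚ.+_) (sumL-const xs δ) ⟩
      δ ℚ.+ ℕtoℚ (length xs) ℚ.* δ           ≡⟨ solve 2 (λ d m → d :+ m :* d := (con 1ℚ :+ m) :* d) refl δ (ℕtoℚ (length xs)) ⟩
      (1ℚ ℚ.+ ℕtoℚ (length xs)) ℚ.* δ        ≡⟨ cong (ℚ._* δ) (trans (sym (ℕtoℚ-suc (length xs))) (ℕtoℚ-mkℚ (suc (length xs)))) ⟩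
      E+1 ℚ.* (¼ ℚ.* ℚ.1/ E+1)               ≡⟨ solve 3 (λ k q r → k :* (q :* r) := q :* (k :* r)) refl E+1 ¼ (ℚ.1/ E+1) ⟩
      ¼ ℚ.* (E+1 ℚ.* ℚ.1/ E+1)               ≡⟨ trans (cong (¼ ℚ.*_) (ℚP.*-inverseʳ E+1)) (ℚP.*-identityʳ ¼) ⟩
      ¼ ∎
    where open ≡-Reasoning

  ¼<½ : ¼ < ½
  ¼<½ = toWitness {a? = ¼ ℚP.<? ½} _

pairs-nonempty : ∀ m → 1 ≤ length (pairs (suc (suc m)))
pairs-nonempty m = ∈-length (∈-pairs {k = suc (suc m)} {i = Fin.zero} {j = Fin.suc Fin.zero} (s≤s z≤n))

proposition27 : (H : Graph) → HasEdge H → (a b : ℕ) → IsLambdaStar H a b →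
    Σ ℚ (λ c → (0ℚ < c) ×
    ((n : ℕ) → 2 ≤ n → (p : ℚ) → 0ℚ ℚ.≤ p → p ℚ.≤ 1ℚ →
    powℚ p a * powℚ (ℕtoℚ n) b < powℚ c a →
    probPerc n H p < ½))
proposition27 H _ a zero (() , _)
proposition27 H _ zero b _ = 1ℚ , ℚP.positive⁻¹ 1ℚ , λ n n≥2 p _ _ hyp →
  ⊥-elim (zero-exponent-impossible p (ℕtoℚ n) 1ℚ b (ℕtoℚ-≥1 (ℕP.≤-trans (s≤s z≤n) n≥2)) hyp)
proposition27 H _ (suc a′) (suc b′) (_ , _ , sparse) = c , pow-pos b 0<δ , percolation-unlikely
  where
  open Budget (length (pairs (V H)))
  b : ℕ
  b = suc b′
  c : ℚ
  c = powℚ δ b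
  F : ∀ ε → IsEdge H ε → SubgraphMinus H ε
  F ε ε-edge = proj₁ (sparse ε ε-edge)
  percolation-unlikely : (n : ℕ) → 2 ≤ n → (p : ℚ) → 0ℚ ℚ.≤ p → p ℚ.≤ 1ℚ →
                         powℚ p (suc a′) * powℚ (ℕtoℚ n) b < powℚ c (suc a′) → probPerc n H p < ½
  percolation-unlikely zero ()
  percolation-unlikely (suc zero) (s≤s ())
  percolation-unlikely (suc (suc m)) _ p 0≤p p≤1 hyp = begin-strict
      probPerc n H p
        ≤⟨ first-moment-bound δ (ℚP.<⇒≤ 0<δ) copy-unlikely ⟩
      powℚ p (length (pairs n)) ℚ.+ sumL (map (λ _ → δ) (pairs (V H)))
        ≤⟨ ℚP.+-monoˡ-≤ _ complete-unlikely ⟩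
      δ ℚ.+ sumL (map (λ _ → δ) (pairs (V H)))
        ≡⟨ budget (pairs (V H)) refl ⟩
      ¼ <⟨ ¼<½ ⟩
      ½ ∎
    where
    open ℚP.≤-Reasoning
    n : ℕ
    n = suc (suc m)
    open FirstMoment {n} H Fin.zero p 0≤p p≤1 F
    copy-unlikely : ∀ ε (ε-edge : IsEdge H ε) → powℚ (ℕtoℚ n) (vF (F ε ε-edge)) ℚ.* powℚ p (eF (F ε ε-edge)) ℚ.≤ δ
    copy-unlikely ε ε-edge = density-bound (ℕtoℚ n) p δ a′ b′ (vF (F ε ε-edge)) (eF (F ε ε-edge))
      (ℕtoℚ-nonNeg n) 0≤p p≤1 (ℚP.<⇒≤ 0<δ) δ≤1
      (proj₁ (proj₂ (sparse ε ε-edge))) (proj₂ (proj₂ (sparse ε ε-edge))) (ℚP.<⇒≤ hyp)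
    complete-unlikely : powℚ p (length (pairs n)) ℚ.≤ δ
    complete-unlikely = ℚP.≤-trans (pow-antitone 1 _ 0≤p p≤1 (pairs-nonempty m))
      (ℚP.≤-trans (ℚP.≤-reflexive (pow-1 p)) (p≤δ p (ℕtoℚ n) δ a′ b′ 0≤p (ℚP.<⇒≤ 0<δ) δ≤1 (ℕtoℚ-≥1 {n} (s≤s z≤n)) hyp))
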